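{- Let $h\geq k\geq 1$ and consider a rectangular board with $2h-1$ rows and at least $k+1$ columns. Let $L_h$ denote the polyomino of width $2$ whose left column consists of $h$ cells and whose right column consists of a single cell adjacent to the bottom cell of the left column. Then the number of ways to place $k$ pairwise non-overlapping translates of $L_h$ on the board (each fully inside the board) such that all $k$ anchor squares lie in the first $k$ columns is $\binom{h}{k}$.
   Context: The anchor square of a placed translate of $L_h$ is its lower-left cell (the bottom cell of its left column). -}

module Defs where

open import Data.Nat using (ℕ; suc; _+_; _*_; _∸_; _≤_; _<_)
open import Data.Nat.Properties using (_≟_; _≤?_; _<?_)
open import Data.Bool using (Bool; true)
import Data.Bool.Properties as B
open import Data.Fin using (Fin; toℕ)
open import Data.Fin.Properties using (all?)
import Data.Fin.Properties as F
open import Data.Fin.Subset using (Subset; ∣_∣)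
open import Data.Vec using (Vec; lookup; map; sum)
open import Data.Product using (_×_; Σ)
open import Data.Sum using (_⊎_)
open import Relation.Binary.PropositionalEquality using (_≡_)
open import Relation.Nullary using (¬_; Dec)
open import Relation.Nullary.Decidable using (True; _×-dec_; _⊎-dec_; _→-dec_; ¬?)

rows : ℕ → ℕ
rows h = 2 * h ∸ 1

-- A translate of L_h is determined by its anchor (lower-left cell), so a
-- placement (an unordered set of translates) is a set of anchor squares.
AnchorSet : ℕ → ℕ → Set
AnchorSet m n = Vec (Subset n) m

isAnchor : ∀ {m n} → AnchorSet m n → Fin m → Fin n → Set
isAnchor S c r = lookup (lookup S c) r ≡ true

card : ∀ {m n} → AnchorSet m n → ℕ
card S = sum (map ∣_∣ S)

-- The translate of L_h with anchor (column c, row r) (rows counted upward from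
-- the bottom, columns from the left, starting at 0) covers cell (column x, row y):
-- left column: cells (c , r) ... (c , r + h - 1); right column: the cell (c + 1 , r).
Covers : (h c r x y : ℕ) → Set
Covers h c r x y = (x ≡ c × r ≤ y × y < r + h) ⊎ (x ≡ suc c × y ≡ r)

covers? : ∀ h c r x y → Dec (Covers h c r x y)
covers? h c r x y = (x ≟ c ×-dec (r ≤? y ×-dec y <? r + h)) ⊎-dec (x ≟ suc c ×-dec y ≟ r)

Inside : (h m c r : ℕ) → Set
Inside h m c r = suc c < m × r + h ≤ rows h

Valid : (h k m : ℕ) → AnchorSet m (rows h) → Set
Valid h k m S =
    card S ≡ k
  × (∀ c r → isAnchor S c r → (toℕ c < k × Inside h m (toℕ c) (toℕ r)))
  × (∀ c r c' r' → isAnchor S c r → isAnchor S c' r' → ¬ (c ≡ c' × r ≡ r') →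
       ∀ (x : Fin m) (y : Fin (rows h)) →
         ¬ (Covers h (toℕ c) (toℕ r) (toℕ x) (toℕ y) × Covers h (toℕ c') (toℕ r') (toℕ x) (toℕ y)))

anchor? : ∀ {m n} (S : AnchorSet m n) c r → Dec (isAnchor S c r)
anchor? S c r = lookup (lookup S c) r B.≟ true

valid? : ∀ h k m S → Dec (Valid h k m S)
valid? h k m S = (card S ≟ k) ×-dec (inside? ×-dec disjoint?)
  where
  inside? = all? λ c → all? λ r → anchor? S c r →-dec
              (toℕ c <? k ×-dec (suc (toℕ c) <? m ×-dec toℕ r + h ≤? rows h))
  disjoint? = all? λ c → all? λ r → all? λ c' → all? λ r' →
    anchor? S c r →-dec (anchor? S c' r' →-dec
      (¬? ((c F.≟ c') ×-dec (r F.≟ r')) →-dec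
        all? λ x → all? λ y →
          ¬? (covers? h (toℕ c) (toℕ r) (toℕ x) (toℕ y) ×-dec covers? h (toℕ c') (toℕ r') (toℕ x) (toℕ y))))

-- The placements: anchor sets satisfying Valid (the decidability witness
-- 'True' makes the second component proof-irrelevant, so placements are
-- identified exactly when their anchor sets coincide).
Placement : (h k m : ℕ) → Set
Placement h k m = Σ (AnchorSet m (rows h)) (λ S → True (valid? h k m S))

{-# OPTIONS --safe #-}
module Submission where

-- Two translates anchored in the same column overlap: both contain the higher anchor, since
-- every anchor lies below row h and the board has only 2h - 1 rows. As the k anchors all lie
-- in the first k columns, column c carries exactly one anchor, at some row r_c < h. If
-- r_(c+1) ≤ r_c, the right cell (c + 1, r_c) of the translate in column c lies in the left
-- column of the next one; so r_0 < r_1 < ⋯ < r_(k-1) < h, and conversely every such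
-- sequence is a valid placement. These sequences are the k-subsets of {0, …, h - 1},
-- counted by Pascal's rule.

open import Defs
open import Data.Nat using (ℕ; zero; suc; _≤_; _<_; _+_; z≤n; s≤s; z<s)
open import Data.Nat.Combinatorics using (_C_; nCk+nC[k+1]≡[n+1]C[k+1])
open import Data.Nat.Properties
open import Data.Fin using (Fin; zero; suc; toℕ; fromℕ<)
import Data.Fin.Properties as Fin
open import Data.Fin.Subset using (Subset; _∈_; _⊆_; ⁅_⁆; ∣_∣; Nonempty; Empty)
open import Data.Fin.Subset.Properties
  using (nonempty?; Empty-unique; ∣⊥∣≡0; ∣⁅x⁆∣≡1; x∈⁅x⁆; x∈⁅y⁆⇒x≡y; p⊆q⇒∣p∣≤∣q∣; ⊆-antisym)
open import Data.Bool using (Bool; true; false)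
open import Data.Bool.Properties using (¬-not; not-¬; T-irrelevant)
open import Data.Product using (Σ-syntax; ∃-syntax; _×_; _,_; proj₁; proj₂)
open import Data.Sum using (_⊎_; inj₁; inj₂; [_,_])
open import Data.Sum.Function.Propositional using (_⊎-↔_)
open import Data.Vec using (Vec; []; _∷_; lookup; tabulate; map; sum)
open import Data.Vec.Properties using (lookup∘tabulate; lookup-map; []=⇒lookup; lookup⇒[]=)
open import Data.Vec.Relation.Binary.Pointwise.Extensional using (ext; Pointwise-≡⇒≡)
open import Function using (_∘_; case_of_)
open import Function.Bundles using (_⤖_; _↔_; _⇔_; mk↔ₛ′; mk⇔; Equivalence)
open import Function.Properties.Inverse using (↔-trans; ↔⇒⤖)
open import Function.Related.Propositional using (module EquationalReasoning)
open import Relation.Binary.PropositionalEquality using (_≡_; _≢_; refl; sym; trans; cong; subst)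
open import Relation.Nullary using (¬_; yes; no; contradiction)
open import Relation.Nullary.Decidable using (True; toWitness; fromWitness; decidable-stable; _×-dec_)

open Equivalence using (to; from)

private variable
  h k m n : ℕ

-- k-subsets of {0, …, n - 1}

data Combination : ℕ → ℕ → Set where
  done : Combination 0 0
  keep : ∀ {n k} → Combination n k → Combination (suc n) (suc k)
  skip : ∀ {n k} → Combination n k → Combination (suc n) k

keep-or-skip : Combination (suc n) (suc k) ↔ (Combination n k ⊎ Combination n (suc k))
keep-or-skip = mk↔ₛ′ split [ keep , skip ]
  (λ { (inj₁ _) → refl ; (inj₂ _) → refl }) (λ { (keep _) → refl ; (skip _) → refl })
  where
  split : Combination (suc n) (suc k) → Combination n k ⊎ Combination n (suc k)
  split (keep s) = inj₁ s
  split (skip s) = inj₂ s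

combination↔Fin : ∀ n k → Combination n k ↔ Fin (n C k)
combination↔Fin zero    zero    =
  mk↔ₛ′ (λ _ → zero) (λ _ → done) (λ { zero → refl ; (suc ()) }) (λ { done → refl })
combination↔Fin zero    (suc k) = mk↔ₛ′ (λ ()) (λ ()) (λ ()) (λ ())
combination↔Fin (suc n) zero    = begin
  Combination (suc n) 0  ↔⟨ mk↔ₛ′ (λ { (skip s) → s }) skip (λ _ → refl) (λ { (skip _) → refl }) ⟩
  Combination n 0        ↔⟨ combination↔Fin n 0 ⟩
  Fin 1                  ∎
  where open EquationalReasoning
combination↔Fin (suc n) (suc k) = begin
  Combination (suc n) (suc k)                ↔⟨ keep-or-skip ⟩
  (Combination n k ⊎ Combination n (suc k))  ↔⟨ combination↔Fin n k ⊎-↔ combination↔Fin n (suc k) ⟩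
  (Fin (n C k) ⊎ Fin (n C suc k))            ↔⟨ Fin.+↔⊎ ⟨
  Fin (n C k + n C suc k)                    ≡⟨ cong Fin (nCk+nC[k+1]≡[n+1]C[k+1] n k) ⟩
  Fin (suc n C suc k)                        ∎
  where open EquationalReasoning

-- Anchor sets over unbounded (column, row) coordinates, independent of the board size.
Pattern : Set
Pattern = ℕ → ℕ → Bool

record Ascending (n k : ℕ) (A : Pattern) : Set where
  field
    bounded    : ∀ {c r} → c < k → A c r ≡ true → r < n
    total      : ∀ {c} → c < k → ∃[ r ] A c r ≡ true
    functional : ∀ {c r r'} → c < k → A c r ≡ true → A c r' ≡ true → r ≡ r'
    increasing : ∀ {c c' r r'} → c < c' → c' < k → A c r ≡ true → A c' r' ≡ true → r < r'
open Ascending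

ascending-zero : ∀ {A} → Ascending n 0 A
ascending-zero = record { bounded = λ () ; total = λ () ; functional = λ () ; increasing = λ _ () }

ascending-skip⁺ : ∀ {A} → Ascending n k A → Ascending (suc n) k A
ascending-skip⁺ asc = record
  { bounded    = λ c<k e → m<n⇒m<1+n (bounded asc c<k e)
  ; total      = total asc
  ; functional = functional asc
  ; increasing = increasing asc
  }

ascending-keep⁺ : ∀ {A B} → Ascending n k A → (∀ {c r} → c < k → B c r ≡ A c r) →
                  B k n ≡ true → (∀ {r} → B k r ≡ true → r ≡ n) → Ascending (suc n) (suc k) B
ascending-keep⁺ {n} {k} {A} {B} asc agree top only-top = record
  { bounded = bounded' ; total = total' ; functional = functional' ; increasing = increasing' }
  where
  below : ∀ {c r} → c < k → B c r ≡ true → A c r ≡ true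
  below c<k e = trans (sym (agree c<k)) e

  bounded' : ∀ {c r} → c < suc k → B c r ≡ true → r < suc n
  bounded' c<1+k e with m<1+n⇒m<n∨m≡n c<1+k
  ... | inj₁ c<k  = m<n⇒m<1+n (bounded asc c<k (below c<k e))
  ... | inj₂ refl = s≤s (≤-reflexive (only-top e))

  total' : ∀ {c} → c < suc k → ∃[ r ] B c r ≡ true
  total' c<1+k with m<1+n⇒m<n∨m≡n c<1+k
  ... | inj₁ c<k  = let (r , e) = total asc c<k in r , trans (agree c<k) e
  ... | inj₂ refl = n , top

  functional' : ∀ {c r r'} → c < suc k → B c r ≡ true → B c r' ≡ true → r ≡ r'
  functional' c<1+k e e' with m<1+n⇒m<n∨m≡n c<1+k
  ... | inj₁ c<k  = functional asc c<k (below c<k e) (below c<k e')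
  ... | inj₂ refl = trans (only-top e) (sym (only-top e'))

  increasing' : ∀ {c c' r r'} → c < c' → c' < suc k → B c r ≡ true → B c' r' ≡ true → r < r'
  increasing' c<c' c'<1+k e e' with m<1+n⇒m<n∨m≡n c'<1+k
  ... | inj₁ c'<k = increasing asc c<c' c'<k (below (<-trans c<c' c'<k) e) (below c'<k e')
  ... | inj₂ refl = subst (_ <_) (sym (only-top e')) (bounded asc c<c' (below c<c' e))

ascending-keep⁻ : ∀ {A} → Ascending (suc n) (suc k) A → A k n ≡ true → Ascending n k A
ascending-keep⁻ asc top = record
  { bounded    = λ c<k e → increasing asc c<k (n<1+n _) e top
  ; total      = λ c<k → total asc (m<n⇒m<1+n c<k)
  ; functional = λ c<k → functional asc (m<n⇒m<1+n c<k)
  ; increasing = λ c<c' c'<k → increasing asc c<c' (m<n⇒m<1+n c'<k)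
  }

ascending-skip⁻ : ∀ {A} → Ascending (suc n) (suc k) A → A k n ≢ true → Ascending n (suc k) A
ascending-skip⁻ {n} {k} {A} asc no-top = record
  { bounded = bounded' ; total = total asc ; functional = functional asc ; increasing = increasing asc }
  where
  bounded' : ∀ {c r} → c < suc k → A c r ≡ true → r < n
  bounded' c<1+k e with m<1+n⇒m<n∨m≡n c<1+k
  ... | inj₂ refl = ≤∧≢⇒< (≤-pred (bounded asc c<1+k e)) (λ { refl → no-top e })
  ... | inj₁ c<k  =
    let (r , e') = total asc (n<1+n k) in
    <-≤-trans (increasing asc c<k (n<1+n k) e e') (≤-pred (bounded asc (n<1+n k) e'))

adjacent⇒increasing : ∀ {A : Pattern} → (∀ {c} → c < k → ∃[ r ] A c r ≡ true) →
  (∀ {c r r'} → suc c < k → A c r ≡ true → A (suc c) r' ≡ true → r < r') →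
  ∀ {c c' r r'} → c < c' → c' < k → A c r ≡ true → A c' r' ≡ true → r < r'
adjacent⇒increasing total adjacent {c' = suc c'} c<1+c' 1+c'<k e e' with m<1+n⇒m<n∨m≡n c<1+c'
... | inj₂ refl = adjacent 1+c'<k e e'
... | inj₁ c<c' =
  let c'<k = <-trans (n<1+n c') 1+c'<k
      (r'' , e'') = total c'<k
  in <-trans (adjacent⇒increasing total adjacent c<c' c'<k e e'') (adjacent 1+c'<k e'' e')

-- The i-th smallest element of a combination becomes the anchor row of column i.
anchors : Combination n k → Pattern
anchors done c r = false
anchors (keep {n} {k} s) c r with c ≟ k | r ≟ n
... | yes _ | yes _ = true
... | yes _ | no  _ = false
... | no  _ | _     = anchors s c r
anchors (skip s) c r = anchors s c r

anchors-keep-other : ∀ {c r} (s : Combination n k) → c ≢ k → anchors (keep s) c r ≡ anchors s c r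
anchors-keep-other {n} {k} {c} {r} s c≢k with c ≟ k | r ≟ n
... | yes c≡k | _ = contradiction c≡k c≢k
... | no  _   | _ = refl

anchors-keep-top : (s : Combination n k) → anchors (keep s) k n ≡ true
anchors-keep-top {n} {k} s with k ≟ k | n ≟ n
... | yes _ | yes _  = refl
... | yes _ | no n≢n = contradiction refl n≢n
... | no k≢k | _     = contradiction refl k≢k

anchors-keep-only-top : ∀ {r} (s : Combination n k) → anchors (keep s) k r ≡ true → r ≡ n
anchors-keep-only-top {n} {k} {r} s e with k ≟ k | r ≟ n
... | yes _  | yes r≡n = r≡n
... | no k≢k | _       = contradiction refl k≢k

anchors⇒col< : ∀ {c r} (s : Combination n k) → anchors s c r ≡ true → c < k
anchors⇒col< {c = c} {r} (keep {n} {k} s) e with c ≟ k | r ≟ n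
... | yes refl | yes _ = n<1+n k
... | no  _    | _     = m<n⇒m<1+n (anchors⇒col< s e)
anchors⇒col< (skip s) e = anchors⇒col< s e

anchors-ascending : (s : Combination n k) → Ascending n k (anchors s)
anchors-ascending done     = ascending-zero
anchors-ascending (keep s) = ascending-keep⁺ (anchors-ascending s)
  (λ c<k → anchors-keep-other s (<⇒≢ c<k)) (anchors-keep-top s) (anchors-keep-only-top s)
anchors-ascending (skip s) = ascending-skip⁺ (anchors-ascending s)

anchors-injective : (s s' : Combination n k) → (∀ {c r} → c < k → anchors s c r ≡ anchors s' c r) → s ≡ s'
anchors-injective done     done      _     = refl
anchors-injective (keep s) (keep s') agree = cong keep (anchors-injective s s' λ c<k →
  trans (sym (anchors-keep-other s (<⇒≢ c<k)))
        (trans (agree (m<n⇒m<1+n c<k)) (anchors-keep-other s' (<⇒≢ c<k))))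
anchors-injective (skip s) (skip s') agree = cong skip (anchors-injective s s' agree)
anchors-injective {suc n} {suc k} (keep s) (skip s') agree =
  contradiction (bounded (anchors-ascending s') (n<1+n k)
                   (trans (sym (agree (n<1+n k))) (anchors-keep-top s))) (n≮n n)
anchors-injective {suc n} {suc k} (skip s) (keep s') agree =
  contradiction (bounded (anchors-ascending s) (n<1+n k)
                   (trans (agree (n<1+n k)) (anchors-keep-top s'))) (n≮n n)

ascending⇒combination : ∀ n k {A} → Ascending n k A →
  Σ[ s ∈ Combination n k ] (∀ {c r} → c < k → anchors s c r ≡ A c r)
ascending⇒combination zero    zero    _   = done , λ ()
ascending⇒combination zero    (suc k) asc = contradiction (bounded asc z<s (proj₂ (total asc z<s))) n≮0
ascending⇒combination (suc n) zero    {A} _ =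
  skip (proj₁ (ascending⇒combination n 0 {A} ascending-zero)) , λ ()
ascending⇒combination (suc n) (suc k) {A} asc with A k n in top
... | false =
  let (s , agree) = ascending⇒combination n (suc k) (ascending-skip⁻ asc (not-¬ top)) in skip s , agree
... | true  =
  let (s , agree) = ascending⇒combination n k (ascending-keep⁻ asc top) in keep s , keep-agrees s agree
  where
  keep-agrees : ∀ s → (∀ {c r} → c < k → anchors s c r ≡ A c r) →
                ∀ {c r} → c < suc k → anchors (keep s) c r ≡ A c r
  keep-agrees s agree {c} {r} c<1+k with m<1+n⇒m<n∨m≡n c<1+k | r ≟ n
  ... | inj₁ c<k  | _        = trans (anchors-keep-other s (<⇒≢ c<k)) (agree c<k)
  ... | inj₂ refl | yes refl = trans (anchors-keep-top s) (sym top)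
  ... | inj₂ refl | no r≢n   =
    trans (¬-not (r≢n ∘ anchors-keep-only-top s))
          (sym (¬-not (λ e → r≢n (functional asc (n<1+n k) e top))))

+h≤rows⇔<h : ∀ {r} → 0 < h → r + h ≤ rows h ⇔ r < h
+h≤rows⇔<h {suc h} {r} _ = mk⇔
  (λ le → s≤s (+-cancelʳ-≤ (suc h) r h (subst (r + suc h ≤_) rows-suc le)))
  (λ { (s≤s r≤h) → subst (r + suc h ≤_) (sym rows-suc) (+-monoˡ-≤ (suc h) r≤h) })
  where
  rows-suc : rows (suc h) ≡ h + suc h
  rows-suc = cong (h +_) (+-identityʳ (suc h))

<h⇒<rows : ∀ {r} → 0 < h → r < h → r < rows h
<h⇒<rows {r = r} 0<h r<h = <-≤-trans (m<m+n r 0<h) (from (+h≤rows⇔<h 0<h) r<h)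

data FinOrBeyond (n : ℕ) : ℕ → Set where
  fin    : (i : Fin n) → FinOrBeyond n (toℕ i)
  beyond : ∀ {i} → n ≤ i → FinOrBeyond n i

finOrBeyond : ∀ n i → FinOrBeyond n i
finOrBeyond zero    i       = beyond z≤n
finOrBeyond (suc n) zero    = fin zero
finOrBeyond (suc n) (suc i) with finOrBeyond n i
... | fin j      = fin (suc j)
... | beyond n≤i = beyond (s≤s n≤i)

finOrBeyond-toℕ : (i : Fin n) → finOrBeyond n (toℕ i) ≡ fin i
finOrBeyond-toℕ zero    = refl
finOrBeyond-toℕ (suc i) rewrite finOrBeyond-toℕ i = refl

anchorAt : AnchorSet m n → Pattern
anchorAt {m} {n} S c r with finOrBeyond m c | finOrBeyond n r
... | fin c' | fin r' = lookup (lookup S c') r'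
... | _      | _      = false

anchorAt-toℕ : (S : AnchorSet m n) (c : Fin m) (r : Fin n) →
               anchorAt S (toℕ c) (toℕ r) ≡ lookup (lookup S c) r
anchorAt-toℕ S c r rewrite finOrBeyond-toℕ c | finOrBeyond-toℕ r = refl

anchorAt-true : ∀ (S : AnchorSet m n) {c r} → anchorAt S c r ≡ true →
  Σ[ c' ∈ Fin m ] Σ[ r' ∈ Fin n ] toℕ c' ≡ c × toℕ r' ≡ r × isAnchor S c' r'
anchorAt-true {m} {n} S {c} {r} e with finOrBeyond m c | finOrBeyond n r
... | fin c'     | fin r'     = c' , r' , refl , refl , e
... | fin _      | beyond _   = contradiction e λ ()
... | beyond _   | _          = contradiction e λ ()

anchorSet : Pattern → AnchorSet m n
anchorSet A = tabulate λ c → tabulate λ r → A (toℕ c) (toℕ r)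

lookup-anchorSet : ∀ A (c : Fin m) (r : Fin n) → lookup (lookup (anchorSet A) c) r ≡ A (toℕ c) (toℕ r)
lookup-anchorSet A c r = trans (cong (λ col → lookup col r) (lookup∘tabulate _ c)) (lookup∘tabulate _ r)

anchorAt-anchorSet : ∀ {A} → (∀ {c r} → A c r ≡ true → c < m × r < n) →
                     ∀ c r → anchorAt (anchorSet {m} {n} A) c r ≡ A c r
anchorAt-anchorSet {m} {n} {A} on-board c r with finOrBeyond m c | finOrBeyond n r
... | fin c'     | fin r'     = lookup-anchorSet A c' r'
... | fin _      | beyond n≤r = sym (¬-not λ e → <⇒≱ (proj₂ (on-board e)) n≤r)
... | beyond m≤c | _          = sym (¬-not λ e → <⇒≱ (proj₁ (on-board e)) m≤c)

anchorSet-anchorAt : ∀ {A} (S : AnchorSet m n) → (∀ c r → A c r ≡ anchorAt S c r) → anchorSet A ≡ S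
anchorSet-anchorAt {A = A} S agree = Pointwise-≡⇒≡ (ext λ c → Pointwise-≡⇒≡ (ext λ r →
  trans (lookup-anchorSet A c r) (trans (agree (toℕ c) (toℕ r)) (anchorAt-toℕ S c r))))

sum-≤ : ∀ k (v : Vec ℕ m) → (∀ i → lookup v i ≤ 1) → (∀ i → k ≤ toℕ i → lookup v i ≡ 0) → sum v ≤ k
sum-≤ _       []      _  _  = z≤n
sum-≤ zero    (x ∷ v) ≤1 ≡0 rewrite ≡0 zero z≤n =
  sum-≤ zero v (λ i → ≤1 (suc i)) (λ i _ → ≡0 (suc i) z≤n)
sum-≤ (suc k) (x ∷ v) ≤1 ≡0 =
  +-mono-≤ (≤1 zero) (sum-≤ k v (λ i → ≤1 (suc i)) (λ i k≤i → ≡0 (suc i) (s≤s k≤i)))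

sum≡⇔ones : ∀ k (v : Vec ℕ m) → k ≤ m → (∀ i → lookup v i ≤ 1) → (∀ i → k ≤ toℕ i → lookup v i ≡ 0) →
            sum v ≡ k ⇔ (∀ i → toℕ i < k → lookup v i ≡ 1)
sum≡⇔ones zero v _ ≤1 ≡0 = mk⇔ (λ _ _ ()) (λ _ → n≤0⇒n≡0 (sum-≤ zero v ≤1 ≡0))
sum≡⇔ones (suc k) (zero ∷ v) _ ≤1 ≡0 = mk⇔
  (λ sum≡ → contradiction (≤-reflexive (sym sum≡))
     (<⇒≱ (s≤s (sum-≤ k v (λ i → ≤1 (suc i)) (λ i k≤i → ≡0 (suc i) (s≤s k≤i))))))
  (λ ones → case ones zero z<s of λ ())
sum≡⇔ones (suc k) (suc zero ∷ v) (s≤s k≤m) ≤1 ≡0 = mk⇔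
  (λ { sum≡ zero _ → refl ; sum≡ (suc i) (s≤s i<k) → to tail (suc-injective sum≡) i i<k })
  (λ ones → cong suc (from tail λ i i<k → ones (suc i) (s≤s i<k)))
  where
  tail : sum v ≡ k ⇔ (∀ i → toℕ i < k → lookup v i ≡ 1)
  tail = sum≡⇔ones k v k≤m (λ i → ≤1 (suc i)) (λ i k≤i → ≡0 (suc i) (s≤s k≤i))
sum≡⇔ones (suc k) (suc (suc x) ∷ v) _ ≤1 _ = contradiction (≤1 zero) λ { (s≤s ()) }

Subsingleton : Subset n → Set
Subsingleton p = ∀ {x y} → x ∈ p → y ∈ p → x ≡ y

subsingleton⊆⁅⁆ : ∀ {p : Subset n} {x} → Subsingleton p → x ∈ p → p ⊆ ⁅ x ⁆
subsingleton⊆⁅⁆ {x = x} unique x∈p y∈p = subst (_∈ ⁅ x ⁆) (unique x∈p y∈p) (x∈⁅x⁆ x)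

Empty⇒∣p∣≡0 : ∀ {p : Subset n} → Empty p → ∣ p ∣ ≡ 0
Empty⇒∣p∣≡0 {n} empty = trans (cong ∣_∣ (Empty-unique empty)) (∣⊥∣≡0 n)

subsingleton⇒∣p∣≤1 : ∀ {p : Subset n} → Subsingleton p → ∣ p ∣ ≤ 1
subsingleton⇒∣p∣≤1 {p = p} unique with nonempty? p
... | yes (x , x∈p) = subst (∣ p ∣ ≤_) (∣⁅x⁆∣≡1 x) (p⊆q⇒∣p∣≤∣q∣ (subsingleton⊆⁅⁆ unique x∈p))
... | no  empty     = m≤n⇒m≤1+n (≤-reflexive (Empty⇒∣p∣≡0 empty))

subsingleton⇒∣p∣≡1⇔Nonempty : ∀ {p : Subset n} → Subsingleton p → ∣ p ∣ ≡ 1 ⇔ Nonempty p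
subsingleton⇒∣p∣≡1⇔Nonempty {p = p} unique = mk⇔
  (λ ∣p∣≡1 → decidable-stable (nonempty? p) λ empty →
     case trans (sym ∣p∣≡1) (Empty⇒∣p∣≡0 empty) of λ ())
  (λ { (x , x∈p) → trans (cong ∣_∣ (p≡⁅x⁆ x∈p)) (∣⁅x⁆∣≡1 x) })
  where
  p≡⁅x⁆ : ∀ {x} → x ∈ p → p ≡ ⁅ x ⁆
  p≡⁅x⁆ {x} x∈p = ⊆-antisym (subsingleton⊆⁅⁆ unique x∈p)
    λ y∈⁅x⁆ → subst (_∈ p) (sym (x∈⁅y⁆⇒x≡y x y∈⁅x⁆)) x∈p

card≡⇔columns-occupied : ∀ k (S : AnchorSet m n) → k ≤ m →
  (∀ {c r r'} → isAnchor S c r → isAnchor S c r' → r ≡ r') →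
  (∀ {c r} → isAnchor S c r → toℕ c < k) →
  card S ≡ k ⇔ (∀ c → toℕ c < k → ∃[ r ] isAnchor S c r)
card≡⇔columns-occupied k S k≤m functional col< = mk⇔
  (λ card≡k c c<k →
     let (r , r∈) = to (count≡1⇔occupied c) (to sums card≡k c c<k) in r , []=⇒lookup r∈)
  (λ occupied → from sums λ c c<k →
     from (count≡1⇔occupied c) (let (r , a) = occupied c c<k in r , lookup⇒[]= r _ a))
  where
  count : ∀ c → lookup (map ∣_∣ S) c ≡ ∣ lookup S c ∣
  count c = lookup-map c ∣_∣ S

  column-subsingleton : ∀ c → Subsingleton (lookup S c)
  column-subsingleton c r∈ r'∈ = functional ([]=⇒lookup r∈) ([]=⇒lookup r'∈)

  count≡1⇔occupied : ∀ c → lookup (map ∣_∣ S) c ≡ 1 ⇔ Nonempty (lookup S c)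
  count≡1⇔occupied c rewrite count c = subsingleton⇒∣p∣≡1⇔Nonempty (column-subsingleton c)

  sums : card S ≡ k ⇔ (∀ c → toℕ c < k → lookup (map ∣_∣ S) c ≡ 1)
  sums = sum≡⇔ones k (map ∣_∣ S) k≤m
    (λ c → subst (_≤ 1) (sym (count c)) (subsingleton⇒∣p∣≤1 (column-subsingleton c)))
    (λ c k≤c → trans (count c)
       (Empty⇒∣p∣≡0 {p = lookup S c} λ (r , r∈) → <⇒≱ (col< ([]=⇒lookup r∈)) k≤c))

-- Overlapping translates

ascending-overlap⇒≡ : ∀ {A c r c' r' x y} → Ascending n k A → (∀ {c r} → A c r ≡ true → c < k) →
  A c r ≡ true → A c' r' ≡ true → Covers h c r x y → Covers h c' r' x y → c ≡ c' × r ≡ r'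
ascending-overlap⇒≡ asc col< e e' (inj₁ (refl , _)) (inj₁ (refl , _)) = refl , functional asc (col< e) e e'
ascending-overlap⇒≡ asc col< e e' (inj₁ (refl , r≤y , _)) (inj₂ (refl , refl)) =
  contradiction r≤y (<⇒≱ (increasing asc (n<1+n _) (col< e) e' e))
ascending-overlap⇒≡ asc col< e e' (inj₂ (refl , refl)) (inj₁ (refl , r'≤y , _)) =
  contradiction r'≤y (<⇒≱ (increasing asc (n<1+n _) (col< e') e e'))
ascending-overlap⇒≡ asc col< e e' (inj₂ (refl , refl)) (inj₂ (refl , refl)) = refl , refl

module _ (0<h : 0 < h) (k≤m : k ≤ m) {S : AnchorSet m (rows h)} (valid : Valid h k m S) where
  anchor-col< : ∀ {c r} → isAnchor S c r → toℕ c < k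
  anchor-col< a = proj₁ (proj₁ (proj₂ valid) _ _ a)

  anchor-row< : ∀ {c r} → isAnchor S c r → toℕ r < h
  anchor-row< a = to (+h≤rows⇔<h 0<h) (proj₂ (proj₂ (proj₁ (proj₂ valid) _ _ a)))

  overlap⇒≡ : ∀ {c r c' r'} (x : Fin m) (y : Fin (rows h)) → isAnchor S c r → isAnchor S c' r' →
    Covers h (toℕ c) (toℕ r) (toℕ x) (toℕ y) → Covers h (toℕ c') (toℕ r') (toℕ x) (toℕ y) → c ≡ c' × r ≡ r'
  overlap⇒≡ {c} {r} {c'} {r'} x y a a' cov cov' =
    decidable-stable (c Fin.≟ c' ×-dec r Fin.≟ r') λ distinct →
      proj₂ (proj₂ valid) c r c' r' a a' distinct x y (cov , cov')

  -- The cell (c, r') lies in both translates.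
  column-functional-≤ : ∀ {c r c' r'} → isAnchor S c r → isAnchor S c' r' → toℕ c ≡ toℕ c' →
                        toℕ r ≤ toℕ r' → r ≡ r'
  column-functional-≤ {c} {r} {c'} {r'} a a' c≡c' r≤r' = proj₂ (overlap⇒≡ c r' a a'
    (inj₁ (refl , r≤r' , <-≤-trans (anchor-row< a') (m≤n+m h (toℕ r))))
    (inj₁ (c≡c' , ≤-refl , m<m+n (toℕ r') 0<h)))

  column-functional : ∀ {c r c' r'} → isAnchor S c r → isAnchor S c' r' → toℕ c ≡ toℕ c' → r ≡ r'
  column-functional {r = r} {r' = r'} a a' c≡c' with ≤-total (toℕ r) (toℕ r')
  ... | inj₁ r≤r' = column-functional-≤ a a' c≡c' r≤r'
  ... | inj₂ r'≤r = sym (column-functional-≤ a' a (sym c≡c') r'≤r)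

  -- Otherwise the cell (c + 1, r) lies in both translates.
  adjacent-increasing : ∀ {c r c' r'} → isAnchor S c r → isAnchor S c' r' → toℕ c' ≡ suc (toℕ c) →
                        toℕ r < toℕ r'
  adjacent-increasing {c} {r} {c'} {r'} a a' c'≡1+c with toℕ r' ≤? toℕ r
  ... | no  r'≰r = ≰⇒> r'≰r
  ... | yes r'≤r = contradiction (cong toℕ (proj₁ (overlap⇒≡ c' r a a'
          (inj₂ (c'≡1+c , refl)) (inj₁ (refl , r'≤r , <-≤-trans (anchor-row< a) (m≤n+m h (toℕ r')))))))
        λ c≡c' → 1+n≢n (sym (trans c≡c' c'≡1+c))

  valid⇒col< : ∀ {c r} → anchorAt S c r ≡ true → c < k
  valid⇒col< e with anchorAt-true S e
  ... | _ , _ , refl , refl , a = anchor-col< a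

  valid⇒ascending : Ascending h k (anchorAt S)
  valid⇒ascending = record
    { bounded    = bounded'
    ; total      = total'
    ; functional = functional'
    ; increasing = adjacent⇒increasing total' adjacent
    }
    where
    bounded' : ∀ {c r} → c < k → anchorAt S c r ≡ true → r < h
    bounded' _ e with anchorAt-true S e
    ... | _ , _ , refl , refl , a = anchor-row< a

    total' : ∀ {c} → c < k → ∃[ r ] anchorAt S c r ≡ true
    total' {c} c<k =
      let c<m      = <-≤-trans c<k k≤m
          c'≡c     = Fin.toℕ-fromℕ< c<m
          occupied = to (card≡⇔columns-occupied k S k≤m (λ a a' → column-functional a a' refl) anchor-col<)
                        (proj₁ valid)
          (r , a)  = occupied (fromℕ< c<m) (subst (_< k) (sym c'≡c) c<k)
      in toℕ r , subst (λ c → anchorAt S c (toℕ r) ≡ true) c'≡c (trans (anchorAt-toℕ S _ r) a)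

    functional' : ∀ {c r r'} → c < k → anchorAt S c r ≡ true → anchorAt S c r' ≡ true → r ≡ r'
    functional' _ e e' with anchorAt-true S e | anchorAt-true S e'
    ... | _ , _ , refl , refl , a | _ , _ , c'≡c , refl , a' = cong toℕ (column-functional a a' (sym c'≡c))

    adjacent : ∀ {c r r'} → suc c < k → anchorAt S c r ≡ true → anchorAt S (suc c) r' ≡ true → r < r'
    adjacent _ e e' with anchorAt-true S e | anchorAt-true S e'
    ... | _ , _ , refl , refl , a | _ , _ , c'≡1+c , refl , a' = adjacent-increasing a a' c'≡1+c

module _ (0<h : 0 < h) (k<m : k < m) {A : Pattern} (asc : Ascending h k A)
         (col< : ∀ {c r} → A c r ≡ true → c < k) where

  private
    S : AnchorSet m (rows h)
    S = anchorSet A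

    anchor⇒pattern : ∀ {c r} → isAnchor S c r → A (toℕ c) (toℕ r) ≡ true
    anchor⇒pattern {c} {r} a = trans (sym (lookup-anchorSet A c r)) a

  ascending⇒valid : Valid h k m S
  ascending⇒valid = card≡k , inside , disjoint
    where
    occupied : ∀ c → toℕ c < k → ∃[ r ] isAnchor S c r
    occupied c c<k =
      let (r , e) = total asc c<k
          r<rows  = <h⇒<rows 0<h (bounded asc c<k e)
      in fromℕ< r<rows , trans (lookup-anchorSet A c _)
                               (subst (λ r → A (toℕ c) r ≡ true) (sym (Fin.toℕ-fromℕ< r<rows)) e)

    card≡k : card S ≡ k
    card≡k = from (card≡⇔columns-occupied k S (<⇒≤ k<m)
      (λ a a' → Fin.toℕ-injective
         (functional asc (col< (anchor⇒pattern a)) (anchor⇒pattern a) (anchor⇒pattern a')))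
      (col< ∘ anchor⇒pattern)) occupied

    inside : ∀ c r → isAnchor S c r → toℕ c < k × Inside h m (toℕ c) (toℕ r)
    inside c r a = let e = anchor⇒pattern a in
      col< e , ≤-trans (s≤s (col< e)) k<m , from (+h≤rows⇔<h 0<h) (bounded asc (col< e) e)

    disjoint : ∀ c r c' r' → isAnchor S c r → isAnchor S c' r' → ¬ (c ≡ c' × r ≡ r') →
      ∀ x y → ¬ (Covers h (toℕ c) (toℕ r) (toℕ x) (toℕ y) × Covers h (toℕ c') (toℕ r') (toℕ x) (toℕ y))
    disjoint c r c' r' a a' distinct x y (cov , cov') =
      let (c≡c' , r≡r') = ascending-overlap⇒≡ asc col< (anchor⇒pattern a) (anchor⇒pattern a') cov cov'
      in distinct (Fin.toℕ-injective c≡c' , Fin.toℕ-injective r≡r')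

-- Placements as combinations

placement-≡ : ∀ {S T} → S ≡ T → (v : True (valid? h k m S)) (w : True (valid? h k m T)) →
              _≡_ {A = Placement h k m} (S , v) (T , w)
placement-≡ refl v w = cong (_ ,_) (T-irrelevant v w)

placement↔combination : 0 < h → k < m → Placement h k m ↔ Combination h k
placement↔combination {h} {k} {m} 0<h k<m = mk↔ₛ′ decode encode decode-encode encode-decode
  where
  decodeΣ : ∀ {S} → Valid h k m S →
            Σ[ s ∈ Combination h k ] (∀ {c r} → c < k → anchors s c r ≡ anchorAt S c r)
  decodeΣ valid = ascending⇒combination h k (valid⇒ascending 0<h (<⇒≤ k<m) valid)

  decode : Placement h k m → Combination h k
  decode (S , v) = proj₁ (decodeΣ (toWitness v))

  encode : Combination h k → Placement h k m
  encode s =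
    anchorSet (anchors s) , fromWitness (ascending⇒valid 0<h k<m (anchors-ascending s) (anchors⇒col< s))

  on-board : ∀ (s : Combination h k) {c r} → anchors s c r ≡ true → c < m × r < rows h
  on-board s e =
    <-trans (anchors⇒col< s e) k<m , <h⇒<rows 0<h (bounded (anchors-ascending s) (anchors⇒col< s e) e)

  decode-encode : ∀ s → decode (encode s) ≡ s
  decode-encode s = anchors-injective _ s λ {c} {r} c<k →
    trans (proj₂ (decodeΣ (toWitness (proj₂ (encode s)))) c<k) (anchorAt-anchorSet (on-board s) c r)

  encode-decode : ∀ p → encode (decode p) ≡ p
  encode-decode (S , v) = placement-≡ (anchorSet-anchorAt S agree) _ v
    where
    valid : Valid h k m S
    valid = toWitness v

    s : Combination h k
    s = decode (S , v)

    agree : ∀ c r → anchors s c r ≡ anchorAt S c r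
    agree c r with c <? k
    ... | yes c<k = proj₂ (decodeΣ valid) c<k
    ... | no  c≮k =
      trans (¬-not (c≮k ∘ anchors⇒col< s)) (sym (¬-not (c≮k ∘ valid⇒col< 0<h (<⇒≤ k<m) valid)))

lemma2p3 : (h k m : ℕ) → 1 ≤ k → k ≤ h → k + 1 ≤ m →
    Placement h k m ⤖ Fin (h C k)
lemma2p3 h k m 1≤k k≤h k+1≤m = ↔⇒⤖ (↔-trans
  (placement↔combination (≤-trans 1≤k k≤h) (subst (_≤ m) (+-comm k 1) k+1≤m))
  (combination↔Fin h k))
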